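{- Let $\overline{(\cdot)}$ be the CGPS translation from $\lambda2\mathbf{J}^{\mathbf{mse}}$ into the domain-free second-order $\lambda$-calculus $\underline{\lambda}2$ described in the context. If $t\rightarrow u$ in $\lambda2\mathbf{J}^{\mathbf{mse}}$, then $\overline{t}\rightarrow^+_\beta\overline{u}$ in $\underline{\lambda}2$.
   Context: $\lambda2\mathbf{J}^{\mathbf{mse}}$: types $A,B::=X\mid A\supset B\mid\forall X.A$; terms $t,u::=x\mid\lambda x.t\mid\Lambda X.t\mid\{c\}$; co-terms $l::=[]\mid u::l\mid B::l\mid(x)c$ ($B$ a type); commands $c::=t\,l$. Evaluation contexts $E::=[]\mid u::l\mid B::l$. Writing $U$ for a term or a type: $[]@l'=l'$, $(U::l)@l'=U::(l@l')$, $((x)t\,l)@l'=(x)t(l@l')$. Reduction: closure under all constructors of $(\beta)\ (\lambda x.t)(u::l)\rightarrow u((x)t\,l)$; $(\beta2)\ (\Lambda X.t)(B::l)\rightarrow([B/X]t)\,l$; $(\pi)\ \{t\,l\}E\rightarrow t(l@E)$; $(\sigma)\ t(x)c\rightarrow[t/x]c$; $(\mu)\ (x)x\,l\rightarrow l$ if $x\notin l$; $(\epsilon)\ \{t[]\}\rightarrow t$ ($[B/X]$ is type substitution). $\underline{\lambda}2$: terms $x\mid\lambda x.t\mid tu\mid\Lambda X.t\mid tA$, with $\beta$-reduction meaning the compatible closure of $(\lambda x.t)u\rightarrow[u/x]t$ and $(\Lambda X.t)B\rightarrow[B/X]t$. Translation: $\bot$ fixed type variable, $\neg A=A\supset\bot$;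 $\mathsf{s}$ a fixed closed term with $\mathsf{s}\,G\rightarrow^+_\beta G$ (e.g. $\lambda z.z$), $G^+=\mathsf{s}\,G$; $[t;u]=(\lambda y.t)u$ with $y\notin t$. Types: $\overline{A}=\top\supset\neg\neg A^*$, $X^*=X$, $(A\supset B)^*=\neg\overline{B}\supset\neg\overline{A}$, $(\forall X.A)^*=\forall X.\overline{A}$. Expressions ($w,m$ fresh): $(x:G,K)=x\,G^+K$; $(\lambda x.t:G,K)=[K(\lambda wx.w\,\overline{t});G]$; $(\Lambda X.t:G,K)=[K(\Lambda X.\overline{t});G]$; $(\{c\}:G,K)=(c:G^+,K)$; $([]:G,K)=\lambda w.wGK$; $(u::l:G,K)=\lambda w.wG(\lambda m.m\,(l:G,K)\,\overline{u})$; $(B::l:G,K)=\lambda w.wG(\lambda m.(l:G,K)(mB^*))$; $((x)c:G,K)=\lambda x.(c:G,K)$; $(t[]:G,K)=(t:G,K)$; $(t(u::l):G,K)=(t:G,\lambda m.m\,(l:G,K)\,\overline{u})$; $(t(B::l):G,K)=(t:G,\lambda m.(l:G,K)(mB^*))$; $(t(x)c:G,K)=((x)c:G,K)\,\overline{t}$; $\overline{t}=\lambda gk.(t:g,k)$ with $g,k$ fresh. -}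

module Defs where

open import Data.Nat using (ℕ; zero; suc)
open import Data.Fin using (Fin; zero; suc)
import Data.Fin as Fin
open import Function using (_∘_; id)
open import Relation.Binary.Construct.Closure.Transitive using (TransClosure)

-- Intrinsically scoped de Bruijn syntax: n = number of type variables in
-- scope, m = number of term variables in scope.

ext : {m k : ℕ} → (Fin m → Fin k) → Fin (suc m) → Fin (suc k)
ext ρ zero    = zero
ext ρ (suc i) = suc (ρ i)

data SType (n : ℕ) : Set where
  tv   : Fin n → SType n
  _⊃_  : SType n → SType n → SType n
  all  : SType (suc n) → SType n

renSTy : {n k : ℕ} → (Fin n → Fin k) → SType n → SType k
renSTy ρ (tv x)  = tv (ρ x)
renSTy ρ (A ⊃ B) = renSTy ρ A ⊃ renSTy ρ B
renSTy ρ (all A) = all (renSTy (ext ρ) A)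

extsSTy : {n k : ℕ} → (Fin n → SType k) → Fin (suc n) → SType (suc k)
extsSTy σ zero    = tv zero
extsSTy σ (suc i) = renSTy suc (σ i)

subSTy : {n k : ℕ} → (Fin n → SType k) → SType n → SType k
subSTy σ (tv x)  = σ x
subSTy σ (A ⊃ B) = subSTy σ A ⊃ subSTy σ B
subSTy σ (all A) = all (subSTy (extsSTy σ) A)

mutual
  data STerm (n m : ℕ) : Set where
    var   : Fin m → STerm n m
    lam   : STerm n (suc m) → STerm n m
    Lam   : STerm (suc n) m → STerm n m
    brace : SCmd n m → STerm n m

  -- co-terms  l ::= [] | u :: l | B :: l | (x)c
  data SCoterm (n m : ℕ) : Set where
    nil   : SCoterm n m
    cons  : STerm n m → SCoterm n m → SCoterm n m
    tcons : SType n → SCoterm n m → SCoterm n m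
    mu    : SCmd n (suc m) → SCoterm n m

  data SCmd (n m : ℕ) : Set where
    cut : STerm n m → SCoterm n m → SCmd n m

mutual
  renT : {n m k : ℕ} → (Fin m → Fin k) → STerm n m → STerm n k
  renT ρ (var x)   = var (ρ x)
  renT ρ (lam t)   = lam (renT (ext ρ) t)
  renT ρ (Lam t)   = Lam (renT ρ t)
  renT ρ (brace c) = brace (renC ρ c)

  renL : {n m k : ℕ} → (Fin m → Fin k) → SCoterm n m → SCoterm n k
  renL ρ nil         = nil
  renL ρ (cons u l)  = cons (renT ρ u) (renL ρ l)
  renL ρ (tcons B l) = tcons B (renL ρ l)
  renL ρ (mu c)      = mu (renC (ext ρ) c)

  renC : {n m k : ℕ} → (Fin m → Fin k) → SCmd n m → SCmd n k
  renC ρ (cut t l) = cut (renT ρ t) (renL ρ l)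

mutual
  renTyT : {n k m : ℕ} → (Fin n → Fin k) → STerm n m → STerm k m
  renTyT ρ (var x)   = var x
  renTyT ρ (lam t)   = lam (renTyT ρ t)
  renTyT ρ (Lam t)   = Lam (renTyT (ext ρ) t)
  renTyT ρ (brace c) = brace (renTyC ρ c)

  renTyL : {n k m : ℕ} → (Fin n → Fin k) → SCoterm n m → SCoterm k m
  renTyL ρ nil         = nil
  renTyL ρ (cons u l)  = cons (renTyT ρ u) (renTyL ρ l)
  renTyL ρ (tcons B l) = tcons (renSTy ρ B) (renTyL ρ l)
  renTyL ρ (mu c)      = mu (renTyC ρ c)

  renTyC : {n k m : ℕ} → (Fin n → Fin k) → SCmd n m → SCmd k m
  renTyC ρ (cut t l) = cut (renTyT ρ t) (renTyL ρ l)

mutual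
  subTyT : {n k m : ℕ} → (Fin n → SType k) → STerm n m → STerm k m
  subTyT σ (var x)   = var x
  subTyT σ (lam t)   = lam (subTyT σ t)
  subTyT σ (Lam t)   = Lam (subTyT (extsSTy σ) t)
  subTyT σ (brace c) = brace (subTyC σ c)

  subTyL : {n k m : ℕ} → (Fin n → SType k) → SCoterm n m → SCoterm k m
  subTyL σ nil         = nil
  subTyL σ (cons u l)  = cons (subTyT σ u) (subTyL σ l)
  subTyL σ (tcons B l) = tcons (subSTy σ B) (subTyL σ l)
  subTyL σ (mu c)      = mu (subTyC σ c)

  subTyC : {n k m : ℕ} → (Fin n → SType k) → SCmd n m → SCmd k m
  subTyC σ (cut t l) = cut (subTyT σ t) (subTyL σ l)

extsS : {n m k : ℕ} → (Fin m → STerm n k) → Fin (suc m) → STerm n (suc k)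
extsS σ zero    = var zero
extsS σ (suc i) = renT suc (σ i)

mutual
  subT : {n m k : ℕ} → (Fin m → STerm n k) → STerm n m → STerm n k
  subT σ (var x)   = σ x
  subT σ (lam t)   = lam (subT (extsS σ) t)
  subT σ (Lam t)   = Lam (subT (renTyT suc ∘ σ) t)
  subT σ (brace c) = brace (subC σ c)

  subL : {n m k : ℕ} → (Fin m → STerm n k) → SCoterm n m → SCoterm n k
  subL σ nil         = nil
  subL σ (cons u l)  = cons (subT σ u) (subL σ l)
  subL σ (tcons B l) = tcons B (subL σ l)
  subL σ (mu c)      = mu (subC (extsS σ) c)

  subC : {n m k : ℕ} → (Fin m → STerm n k) → SCmd n m → SCmd n k
  subC σ (cut t l) = cut (subT σ t) (subL σ l)

sub1C : {n m : ℕ} → STerm n m → SCmd n (suc m) → SCmd n m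
sub1C t = subC (λ { zero → t ; (suc i) → var i })

sub1TyT : {n m : ℕ} → SType n → STerm (suc n) m → STerm n m
sub1TyT B = subTyT (λ { zero → B ; (suc i) → tv i })

_++L_ : {n m : ℕ} → SCoterm n m → SCoterm n m → SCoterm n m
nil         ++L l' = l'
cons u l    ++L l' = cons u (l ++L l')
tcons B l   ++L l' = tcons B (l ++L l')
mu (cut t l) ++L l' = mu (cut t (l ++L renL suc l'))

data IsEval {n m : ℕ} : SCoterm n m → Set where
  evNil   : IsEval nil
  evCons  : (u : STerm n m) (l : SCoterm n m) → IsEval (cons u l)
  evTCons : (B : SType n) (l : SCoterm n m) → IsEval (tcons B l)

mutual
  data _⟶T_ : {n m : ℕ} → STerm n m → STerm n m → Set where
    ε      : {n m : ℕ} {t : STerm n m} → brace (cut t nil) ⟶T t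
    ξlam   : {n m : ℕ} {t t' : STerm n (suc m)} → t ⟶T t' → lam t ⟶T lam t'
    ξLam   : {n m : ℕ} {t t' : STerm (suc n) m} → t ⟶T t' → Lam t ⟶T Lam t'
    ξbrace : {n m : ℕ} {c c' : SCmd n m} → c ⟶C c' → brace c ⟶T brace c'

  data _⟶L_ : {n m : ℕ} → SCoterm n m → SCoterm n m → Set where
    -- (x)x l → l  if x ∉ l  (i.e. the body's co-term is a weakening of l)
    μ      : {n m : ℕ} {l : SCoterm n m} → mu (cut (var zero) (renL suc l)) ⟶L l
    ξcons₁ : {n m : ℕ} {u u' : STerm n m} {l : SCoterm n m} → u ⟶T u' → cons u l ⟶L cons u' l
    ξcons₂ : {n m : ℕ} {u : STerm n m} {l l' : SCoterm n m} → l ⟶L l' → cons u l ⟶L cons u l'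
    ξtcons : {n m : ℕ} {B : SType n} {l l' : SCoterm n m} → l ⟶L l' → tcons B l ⟶L tcons B l'
    ξmu    : {n m : ℕ} {c c' : SCmd n (suc m)} → c ⟶C c' → mu c ⟶L mu c'

  data _⟶C_ : {n m : ℕ} → SCmd n m → SCmd n m → Set where
    β    : {n m : ℕ} {t : STerm n (suc m)} {u : STerm n m} {l : SCoterm n m} →
           cut (lam t) (cons u l) ⟶C cut u (mu (cut t (renL suc l)))
    β2   : {n m : ℕ} {t : STerm (suc n) m} {B : SType n} {l : SCoterm n m} →
           cut (Lam t) (tcons B l) ⟶C cut (sub1TyT B t) l
    π    : {n m : ℕ} {t : STerm n m} {l E : SCoterm n m} → IsEval E →
           cut (brace (cut t l)) E ⟶C cut t (l ++L E)
    σ-rule : {n m : ℕ} {t : STerm n m} {c : SCmd n (suc m)} →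
           cut t (mu c) ⟶C sub1C t c
    ξcut₁ : {n m : ℕ} {t t' : STerm n m} {l : SCoterm n m} → t ⟶T t' → cut t l ⟶C cut t' l
    ξcut₂ : {n m : ℕ} {t : STerm n m} {l l' : SCoterm n m} → l ⟶L l' → cut t l ⟶C cut t l'

-- ⊥ is a fixed type variable (never bound), modelled as a constant `bot`;
-- ⊤ (used in Ā = ⊤ ⊃ ¬¬A*) is likewise a fixed closed type, constant `top`.
data TType (n : ℕ) : Set where
  tv  : Fin n → TType n
  _⇒_ : TType n → TType n → TType n
  all : TType (suc n) → TType n
  bot : TType n
  top : TType n

renTTy : {n k : ℕ} → (Fin n → Fin k) → TType n → TType k
renTTy ρ (tv x)  = tv (ρ x)
renTTy ρ (A ⇒ B) = renTTy ρ A ⇒ renTTy ρ B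
renTTy ρ (all A) = all (renTTy (ext ρ) A)
renTTy ρ bot     = bot
renTTy ρ top     = top

extsTTy : {n k : ℕ} → (Fin n → TType k) → Fin (suc n) → TType (suc k)
extsTTy σ zero    = tv zero
extsTTy σ (suc i) = renTTy suc (σ i)

subTTy : {n k : ℕ} → (Fin n → TType k) → TType n → TType k
subTTy σ (tv x)  = σ x
subTTy σ (A ⇒ B) = subTTy σ A ⇒ subTTy σ B
subTTy σ (all A) = all (subTTy (extsTTy σ) A)
subTTy σ bot     = bot
subTTy σ top     = top

data Tm (n m : ℕ) : Set where
  var  : Fin m → Tm n m
  lam  : Tm n (suc m) → Tm n m
  _·_  : Tm n m → Tm n m → Tm n m
  Lam  : Tm (suc n) m → Tm n m
  _·T_ : Tm n m → TType n → Tm n m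

infixl 7 _·_ _·T_
infix 4 _⟶β_ _⟶β⁺_

renTm : {n m k : ℕ} → (Fin m → Fin k) → Tm n m → Tm n k
renTm ρ (var x)   = var (ρ x)
renTm ρ (lam t)   = lam (renTm (ext ρ) t)
renTm ρ (t · u)   = renTm ρ t · renTm ρ u
renTm ρ (Lam t)   = Lam (renTm ρ t)
renTm ρ (t ·T A)  = renTm ρ t ·T A

renTyTm : {n k m : ℕ} → (Fin n → Fin k) → Tm n m → Tm k m
renTyTm ρ (var x)  = var x
renTyTm ρ (lam t)  = lam (renTyTm ρ t)
renTyTm ρ (t · u)  = renTyTm ρ t · renTyTm ρ u
renTyTm ρ (Lam t)  = Lam (renTyTm (ext ρ) t)
renTyTm ρ (t ·T A) = renTyTm ρ t ·T renTTy ρ A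

subTyTm : {n k m : ℕ} → (Fin n → TType k) → Tm n m → Tm k m
subTyTm σ (var x)  = var x
subTyTm σ (lam t)  = lam (subTyTm σ t)
subTyTm σ (t · u)  = subTyTm σ t · subTyTm σ u
subTyTm σ (Lam t)  = Lam (subTyTm (extsTTy σ) t)
subTyTm σ (t ·T A) = subTyTm σ t ·T subTTy σ A

extsTm : {n m k : ℕ} → (Fin m → Tm n k) → Fin (suc m) → Tm n (suc k)
extsTm σ zero    = var zero
extsTm σ (suc i) = renTm suc (σ i)

subTm : {n m k : ℕ} → (Fin m → Tm n k) → Tm n m → Tm n k
subTm σ (var x)  = σ x
subTm σ (lam t)  = lam (subTm (extsTm σ) t)
subTm σ (t · u)  = subTm σ t · subTm σ u
subTm σ (Lam t)  = Lam (subTm (renTyTm suc ∘ σ) t)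
subTm σ (t ·T A) = subTm σ t ·T A

data _⟶β_ : {n m : ℕ} → Tm n m → Tm n m → Set where
  β     : {n m : ℕ} {t : Tm n (suc m)} {u : Tm n m} →
          lam t · u ⟶β subTm (λ { zero → u ; (suc i) → var i }) t
  β2    : {n m : ℕ} {t : Tm (suc n) m} {B : TType n} →
          Lam t ·T B ⟶β subTyTm (λ { zero → B ; (suc i) → tv i }) t
  ξlam  : {n m : ℕ} {t t' : Tm n (suc m)} → t ⟶β t' → lam t ⟶β lam t'
  ξapp₁ : {n m : ℕ} {t t' u : Tm n m} → t ⟶β t' → t · u ⟶β t' · u
  ξapp₂ : {n m : ℕ} {t u u' : Tm n m} → u ⟶β u' → t · u ⟶β t · u'
  ξLam  : {n m : ℕ} {t t' : Tm (suc n) m} → t ⟶β t' → Lam t ⟶β Lam t'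
  ξtapp : {n m : ℕ} {t t' : Tm n m} {A : TType n} → t ⟶β t' → t ·T A ⟶β t' ·T A

_⟶β⁺_ : {n m : ℕ} → Tm n m → Tm n m → Set
_⟶β⁺_ = TransClosure _⟶β_

embed : {n m : ℕ} → Tm 0 0 → Tm n m
embed s = renTyTm (λ ()) (renTm (λ ()) s)

wk : {n m : ℕ} → Tm n m → Tm n (suc m)
wk = renTm suc

¬ₜ : {n : ℕ} → TType n → TType n
¬ₜ A = A ⇒ bot

mutual
  _* : {n : ℕ} → SType n → TType n
  tv X *    = tv X
  (A ⊃ B) * = ¬ₜ (bar B) ⇒ ¬ₜ (bar A)
  all A *   = all (bar A)

  bar : {n : ℕ} → SType n → TType n
  bar A = top ⇒ ¬ₜ (¬ₜ (A *))

-- To work with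
-- de Bruijn indices, the expression (t : G, K) is computed for a source
-- phrase in scope m whose term variables are mapped by ρ into the target
-- scope k of G and K (type scopes coincide).  The translation proper is
-- the case ρ = id.
module CGPS (s : Tm 0 0) where

  mutual
    trT : {n m k : ℕ} → (Fin m → Fin k) → STerm n m → Tm n k → Tm n k → Tm n k
    trT ρ (var x)   G K = var (ρ x) · (embed s · G) · K
    -- [K(λw x. w t̄); G] = (λy. K(λw.λx. w t̄)) G
    trT ρ (lam t)   G K =
      lam (wk K · lam (lam (var (suc zero) · over (ext (λ i → Fin.suc (Fin.suc (ρ i)))) t))) · G
    trT ρ (Lam t)   G K = lam (wk K · Lam (over (λ i → Fin.suc (ρ i)) t)) · G
    -- ({c} : G, K) = (c : G⁺, K)
    trT ρ (brace c) G K = trC ρ c (embed s · G) K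

    trL : {n m k : ℕ} → (Fin m → Fin k) → SCoterm n m → Tm n k → Tm n k → Tm n k
    trL ρ nil G K = lam (var zero · wk G · wk K)
    trL ρ (cons u l) G K =
      lam (var zero · wk G · lam (var zero · wk (wk (trL ρ l G K)) · wk (wk (over ρ u))))
    trL ρ (tcons B l) G K =
      lam (var zero · wk G · lam (wk (wk (trL ρ l G K)) · (var zero ·T (B *))))
    trL ρ (mu c) G K = lam (trC (ext ρ) c (wk G) (wk K))

    trC : {n m k : ℕ} → (Fin m → Fin k) → SCmd n m → Tm n k → Tm n k → Tm n k
    trC ρ (cut t nil)         G K = trT ρ t G K
    trC ρ (cut t (cons u l))  G K = trT ρ t G (lam (var zero · wk (trL ρ l G K) · wk (over ρ u)))
    trC ρ (cut t (tcons B l)) G K = trT ρ t G (lam (wk (trL ρ l G K) · (var zero ·T (B *))))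
    trC ρ (cut t (mu c))      G K = trL ρ (mu c) G K · over ρ t

    over : {n m k : ℕ} → (Fin m → Fin k) → STerm n m → Tm n k
    over ρ t = lam (lam (trT (λ i → Fin.suc (Fin.suc (ρ i))) t (var (suc zero)) (var zero)))

  ⟦_⟧ : {n m : ℕ} → STerm n m → Tm n m
  ⟦ t ⟧ = over id t

-- Each source step is simulated inside (t : G, K) for arbitrary G and K, by
-- induction on the step; congruence steps go through because (t : G, K) is
-- monotone in G and K.  At the root, β and β2 become the administrative
-- redexes of [K(λwx. w t̄); G] once K is the argument continuation λm. m L ū
-- or λm. L (m B*); ε and π use s G →⁺ G, π after observing that appending an
-- evaluation context E to l replaces K by the continuation of E; σ follows
-- from a substitution lemma in which t̄ G⁺ K reduces to (t : G, K), and μ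
-- from s G →⁺ G or the same lemma.
module Submission where

open import Defs
open import Data.Nat using (ℕ; zero; suc)
open import Data.Fin using (Fin; zero; suc)
open import Data.Product using (∃-syntax; _,_; _×_)
open import Data.Sum using (_⊎_; inj₁; inj₂) renaming (map to ⊎-map)
open import Function using (_∘_; id)
open import Relation.Binary.PropositionalEquality
  using (_≡_; refl; sym; trans; cong; cong₂; subst)
open import Relation.Binary.Construct.Closure.Transitive using ([_]; _∷_; _++_)
open import Relation.Binary.Construct.Closure.ReflexiveTransitive
  using (Star; ε; _◅_; _◅◅_; gmap)

private variable
  n m n' m' k k' : ℕ
  a b c d : Tm n m
  ρ : Fin m → Fin k
  ρ' : Fin m' → Fin k'
  θ : Fin m → STerm n m'
  τ : Fin k → Tm n k'

infix 4 _⟶β*_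
infixr 5 _⁺◅◅_
infixl 4 _⁺≡_

_⟶β*_ : Tm n m → Tm n m → Set
_⟶β*_ = Star _⟶β_

⁺⇒* : a ⟶β⁺ b → a ⟶β* b
⁺⇒* [ r ]    = r ◅ ε
⁺⇒* (r ∷ rs) = r ◅ ⁺⇒* rs

_⁺◅◅_ : a ⟶β⁺ b → b ⟶β* c → a ⟶β⁺ c
[ r ]    ⁺◅◅ ε         = [ r ]
[ r ]    ⁺◅◅ (r' ◅ rs) = r ∷ ([ r' ] ⁺◅◅ rs)
(r ∷ rs) ⁺◅◅ rs'       = r ∷ (rs ⁺◅◅ rs')

≡⇒* : a ≡ b → a ⟶β* b
≡⇒* refl = ε

_⁺≡_ : a ⟶β⁺ b → b ≡ c → a ⟶β⁺ c
rs ⁺≡ refl = rs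

module _ (f : Tm n m → Tm n' m') where

  bind⁺ : (∀ {a b} → a ⟶β b → f a ⟶β⁺ f b) → a ⟶β⁺ b → f a ⟶β⁺ f b
  bind⁺ h [ r ]    = h r
  bind⁺ h (r ∷ rs) = h r ++ bind⁺ h rs

  bind* : (∀ {a b} → a ⟶β b → f a ⟶β⁺ f b) → a ⟶β* b → f a ⟶β* f b
  bind* h ε        = ε
  bind* h (r ◅ rs) = ⁺⇒* (h r) ◅◅ bind* h rs

  map⁺ : (∀ {a b} → a ⟶β b → f a ⟶β f b) → a ⟶β⁺ b → f a ⟶β⁺ f b
  map⁺ h = bind⁺ ([_] ∘ h)

app₁⁺ : a ⟶β⁺ b → a · c ⟶β⁺ b · c
app₁⁺ = map⁺ (_· _) ξapp₁

app₂⁺ : a ⟶β⁺ b → c · a ⟶β⁺ c · b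
app₂⁺ = map⁺ (_ ·_) ξapp₂

app₁* : a ⟶β* b → a · c ⟶β* b · c
app₁* = gmap (_· _) ξapp₁

app₂* : a ⟶β* b → c · a ⟶β* c · b
app₂* = gmap (_ ·_) ξapp₂

app* : a ⟶β* b → c ⟶β* d → a · c ⟶β* b · d
app* p q = app₁* p ◅◅ app₂* q

lam⁺ : {a b : Tm n (suc m)} → a ⟶β⁺ b → lam a ⟶β⁺ lam b
lam⁺ = map⁺ lam ξlam

lam* : {a b : Tm n (suc m)} → a ⟶β* b → lam a ⟶β* lam b
lam* = gmap lam ξlam

Lam⁺ : {a b : Tm (suc n) m} → a ⟶β⁺ b → Lam a ⟶β⁺ Lam b
Lam⁺ = map⁺ Lam ξLam

Lam* : {a b : Tm (suc n) m} → a ⟶β* b → Lam a ⟶β* Lam b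
Lam* = gmap Lam ξLam

-- Renaming and substitution in the target calculus

ext≗extsTTy : {r : Fin n → Fin m} {σ : Fin n → TType m} →
  (∀ i → tv (r i) ≡ σ i) → ∀ i → tv (ext r i) ≡ extsTTy σ i
ext≗extsTTy h zero    = refl
ext≗extsTTy h (suc i) = cong (renTTy suc) (h i)

extsTTy-ext : {σ : Fin m → TType m'} {r : Fin n → Fin m} {σ' : Fin n → TType m'} →
  (∀ i → σ (r i) ≡ σ' i) → ∀ i → extsTTy σ (ext r i) ≡ extsTTy σ' i
extsTTy-ext h zero    = refl
extsTTy-ext h (suc i) = cong (renTTy suc) (h i)
renTTy≗subTTy : {r
 : Fin n → Fin m} {σ : Fin n → TType m} →
  (∀ i → tv (r i) ≡ σ i) → (A : TType n) → renTTy r A ≡ subTTy σ A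
renTTy≗subTTy h (tv x)  = h x
renTTy≗subTTy h (A ⇒ B) = cong₂ _⇒_ (renTTy≗subTTy h A) (renTTy≗subTTy h B)
renTTy≗subTTy h (all A) = cong all (renTTy≗subTTy (ext≗extsTTy h) A)
renTTy≗subTTy h bot = refl
renTTy≗subTTy h top = refl

subTTy-renTTy : {σ : Fin m → TType m'} {r : Fin n → Fin m} {σ' : Fin n → TType m'} →
  (∀ i → σ (r i) ≡ σ' i) → (A : TType n) → subTTy σ (renTTy r A) ≡ subTTy σ' A
subTTy-renTTy h (tv x)  = h x
subTTy-renTTy h (A ⇒ B) = cong₂ _⇒_ (subTTy-renTTy h A) (subTTy-renTTy h B)
subTTy-renTTy h (all A) = cong all (subTTy-renTTy (extsTTy-ext h) A)
subTTy-renTTy h bot = refl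
subTTy-renTTy h top = refl

renTyTm≗subTyTm : {r : Fin n → Fin n'} {σ : Fin n → TType n'} →
  (∀ i → tv (r i) ≡ σ i) → (t : Tm n m) → renTyTm r t ≡ subTyTm σ t
renTyTm≗subTyTm h (var x)  = refl
renTyTm≗subTyTm h (lam t)  = cong lam (renTyTm≗subTyTm h t)
renTyTm≗subTyTm h (t · u)  = cong₂ _·_ (renTyTm≗subTyTm h t) (renTyTm≗subTyTm h u)
renTyTm≗subTyTm h (Lam t) = cong Lam (renTyTm≗subTyTm (ext≗extsTTy h) t)
renTyTm≗subTyTm h (t ·T A) = cong₂ _·T_ (renTyTm≗subTyTm h t) (renTTy≗subTTy h A)

subTyTm-renTyTm : {σ : Fin n' → TType k} {r : Fin n → Fin n'} {σ' : Fin n → TType k} →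
  (∀ i → σ (r i) ≡ σ' i) → (t : Tm n m) → subTyTm σ (renTyTm r t) ≡ subTyTm σ' t
subTyTm-renTyTm h (var x)  = refl
subTyTm-renTyTm h (lam t)  = cong lam (subTyTm-renTyTm h t)
subTyTm-renTyTm h (t · u)  = cong₂ _·_ (subTyTm-renTyTm h t) (subTyTm-renTyTm h u)
subTyTm-renTyTm h (Lam t) = cong Lam (subTyTm-renTyTm (extsTTy-ext h) t)
subTyTm-renTyTm h (t ·T A) = cong₂ _·T_ (subTyTm-renTyTm h t) (subTTy-renTTy h A)

renTyTm-renTm : (r : Fin n → Fin n') (r' : Fin m → Fin m') (t : Tm n m) →
  renTyTm r (renTm r' t) ≡ renTm r' (renTyTm r t)
renTyTm-renTm r r' (var x)  = refl
renTyTm-renTm r r' (lam t)  = cong lam (renTyTm-renTm r (ext r') t)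
renTyTm-renTm r r' (t · u)  = cong₂ _·_ (renTyTm-renTm r r' t) (renTyTm-renTm r r' u)
renTyTm-renTm r r' (Lam t)  = cong Lam (renTyTm-renTm (ext r) r' t)
renTyTm-renTm r r' (t ·T A) = cong (_·T renTTy r A) (renTyTm-renTm r r' t)

subTyTm-renTm : (σ : Fin n → TType n') (r : Fin m → Fin m') (t : Tm n m) →
  subTyTm σ (renTm r t) ≡ renTm r (subTyTm σ t)
subTyTm-renTm σ r (var x)  = refl
subTyTm-renTm σ r (lam t)  = cong lam (subTyTm-renTm σ (ext r) t)
subTyTm-renTm σ r (t · u)  = cong₂ _·_ (subTyTm-renTm σ r t) (subTyTm-renTm σ r u)
subTyTm-renTm σ r (Lam t)  = cong Lam (subTyTm-renTm (extsTTy σ) r t)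
subTyTm-renTm σ r (t ·T A) = cong (_·T subTTy σ A) (subTyTm-renTm σ r t)

ext-∘ : {r : Fin m' → Fin k} {r' : Fin m → Fin m'} {r'' : Fin m → Fin k} →
  (∀ i → r (r' i) ≡ r'' i) → ∀ i → ext r (ext r' i) ≡ ext r'' i
ext-∘ h zero    = refl
ext-∘ h (suc i) = cong suc (h i)

renTm-renTm : {r : Fin m' → Fin k} {r' : Fin m → Fin m'} {r'' : Fin m → Fin k} →
  (∀ i → r (r' i) ≡ r'' i) → (t : Tm n m) → renTm r (renTm r' t) ≡ renTm r'' t
renTm-renTm h (var x)  = cong var (h x)
renTm-renTm h (lam t)  = cong lam (renTm-renTm (ext-∘ h) t)
renTm-renTm h (t · u)  = cong₂ _·_ (renTm-renTm h t) (renTm-renTm h u)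
renTm-renTm h (Lam t)  = cong Lam (renTm-renTm h t)
renTm-renTm h (t ·T A) = cong (_·T A) (renTm-renTm h t)

subTm-renTm : {τ : Fin m' → Tm n k} {r : Fin m → Fin m'} {τ' : Fin m → Tm n k} →
  (∀ i → τ (r i) ≡ τ' i) → (t : Tm n m) → subTm τ (renTm r t) ≡ subTm τ' t
subTm-renTm h (var x)  = h x
subTm-renTm {τ = τ} {r} {τ'} h (lam t) = cong lam (subTm-renTm h' t)
  where h' : ∀ i → extsTm τ (ext r i) ≡ extsTm τ' i
        h' zero    = refl
        h' (suc i) = cong wk (h i)
subTm-renTm h (t · u)  = cong₂ _·_ (subTm-renTm h t) (subTm-renTm h u)
subTm-renTm h (Lam t)  = cong Lam (subTm-renTm (cong (renTyTm suc) ∘ h) t)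
subTm-renTm h (t ·T A) = cong (_·T A) (subTm-renTm h t)

renTm≗subTm : {r : Fin m → Fin k} {τ : Fin m → Tm n k} →
  (∀ i → var (r i) ≡ τ i) → (t : Tm n m) → renTm r t ≡ subTm τ t
renTm≗subTm h (var x)  = h x
renTm≗subTm {r = r} {τ} h (lam t) = cong lam (renTm≗subTm h' t)
  where h' : ∀ i → var (ext r i) ≡ extsTm τ i
        h' zero    = refl
        h' (suc i) = cong wk (h i)
renTm≗subTm h (t · u)  = cong₂ _·_ (renTm≗subTm h t) (renTm≗subTm h u)
renTm≗subTm h (Lam t)  = cong Lam (renTm≗subTm (cong (renTyTm suc) ∘ h) t)
renTm≗subTm h (t ·T A) = cong (_·T A) (renTm≗subTm h t)

renTm-subTm : {r : Fin k → Fin k'} {τ : Fin m → Tm n k} {τ' : Fin m → Tm n k'} →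
  (∀ i → renTm r (τ i) ≡ τ' i) → (t : Tm n m) → renTm r (subTm τ t) ≡ subTm τ' t
renTm-subTm h (var x)  = h x
renTm-subTm {r = r} {τ} {τ'} h (lam t) = cong lam (renTm-subTm h' t)
  where h' : ∀ i → renTm (ext r) (extsTm τ i) ≡ extsTm τ' i
        h' zero    = refl
        h' (suc i) = trans (renTm-renTm (λ _ → refl) (τ i))
                           (trans (sym (renTm-renTm (λ _ → refl) (τ i))) (cong wk (h i)))
renTm-subTm h (t · u)  = cong₂ _·_ (renTm-subTm h t) (renTm-subTm h u)
renTm-subTm {r = r} {τ} {τ'} h (Lam t) = cong Lam (renTm-subTm h' t)
  where h' : ∀ i → renTm r (renTyTm suc (τ i)) ≡ renTyTm suc (τ' i)
        h' i = trans (sym (renTyTm-renTm suc r (τ i))) (cong (renTyTm suc) (h i))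
renTm-subTm h (t ·T A) = cong (_·T A) (renTm-subTm h t)

subTm-id : {τ : Fin m → Tm n m} → (∀ i → τ i ≡ var i) → (t : Tm n m) → subTm τ t ≡ t
subTm-id h (var x)  = h x
subTm-id {τ = τ} h (lam t) = cong lam (subTm-id h' t)
  where h' : ∀ i → extsTm τ i ≡ var i
        h' zero    = refl
        h' (suc i) = cong wk (h i)
subTm-id h (t · u)  = cong₂ _·_ (subTm-id h t) (subTm-id h u)
subTm-id h (Lam t)  = cong Lam (subTm-id (cong (renTyTm suc) ∘ h) t)
subTm-id h (t ·T A) = cong (_·T A) (subTm-id h t)

subTm-wk : {τ : Fin (suc m) → Tm n m} → (∀ i → τ (suc i) ≡ var i) → (t : Tm n m) →
  subTm τ (wk t) ≡ t
subTm-wk h t = trans (subTm-renTm h t) (subTm-id (λ _ → refl) t)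

subTm-extsTm-wk : (τ : Fin m → Tm n k) (t : Tm n m) → subTm (extsTm τ) (wk t) ≡ wk (subTm τ t)
subTm-extsTm-wk τ t = trans (subTm-renTm (λ _ → refl) t) (sym (renTm-subTm (λ _ → refl) t))

renTm-ext-wk : (t : Tm n m) → renTm (ext suc) (wk t) ≡ wk (wk t)
renTm-ext-wk t = trans (renTm-renTm (λ _ → refl) t) (sym (renTm-renTm (λ _ → refl) t))

-- Distinct functions out of Fin 0 are not definitionally equal, hence the two
-- arbitrary maps r and r' below.
subTm-renTm-closed : {τ : Fin m → Tm n k} (r : Fin 0 → Fin m) (r' : Fin 0 → Fin k)
  (t : Tm n 0) → subTm τ (renTm r t) ≡ renTm r' t
subTm-renTm-closed r r' t = trans (subTm-renTm (λ ()) t) (sym (renTm≗subTm (λ _ → refl) t))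

subTyTm-renTyTm-closed : {σ : Fin n → TType n'} (r : Fin 0 → Fin n) (r' : Fin 0 → Fin n')
  (t : Tm 0 m) → subTyTm σ (renTyTm r t) ≡ renTyTm r' t
subTyTm-renTyTm-closed r r' t =
  trans (subTyTm-renTyTm (λ ()) t) (sym (renTyTm≗subTyTm (λ _ → refl) t))

subTm-embed : (τ : Fin m → Tm n k) (s : Tm 0 0) → subTm τ (embed s) ≡ embed s
subTm-embed τ s =
  trans (cong (subTm τ) (renTyTm-renTm _ _ s))
        (trans (subTm-renTm-closed _ _ _) (sym (renTyTm-renTm _ _ s)))

subTyTm-embed : (σ : Fin n → TType n') (s : Tm 0 0) → subTyTm σ (embed {m = m} s) ≡ embed s
subTyTm-embed σ s = subTyTm-renTyTm-closed _ _ _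

-- The β-rules of Defs substitute with a pattern lambda that cannot be named
-- here, so reducts are identified up to any pointwise-equal substitution.
IsSub₀ : (Fin (suc m) → Tm n m) → Tm n m → Set
IsSub₀ σ u = σ zero ≡ u × (∀ i → σ (suc i) ≡ var i)

β-step : {t : Tm n (suc m)} {u v : Tm n m} →
  (∀ {σ} → IsSub₀ σ u → subTm σ t ≡ v) → lam t · u ⟶β v
β-step h = subst (lam _ · _ ⟶β_) (h (refl , λ _ → refl)) β

β-steps : {t : Tm n (suc m)} {u v : Tm n m} →
  (∀ {σ} → IsSub₀ σ u → subTm σ t ⟶β* v) → lam t · u ⟶β⁺ v
β-steps h = [ β ] ⁺◅◅ h (refl , λ _ → refl)

β2-step : {t : Tm (suc n) m} {B : TType n} {v : Tm n m} →
  (∀ {σ} → σ zero ≡ B → (∀ i → σ (suc i) ≡ tv i) → subTyTm σ t ≡ v) →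
  Lam t ·T B ⟶β v
β2-step h = subst (Lam _ ·T _ ⟶β_) (h refl (λ _ → refl)) β2

renTm-⟶β : (r : Fin m → Fin k) → a ⟶β b → renTm r a ⟶β renTm r b
renTm-⟶β r (β {t = t}) = β-step λ (σ-zero , σ-suc) →
  trans (subTm-renTm {τ' = renTm r ∘ _} (λ { zero → σ-zero ; (suc i) → σ-suc (r i) }) t)
        (sym (renTm-subTm (λ _ → refl) t))
renTm-⟶β r (β2 {t = t}) = subst (Lam (renTm r t) ·T _ ⟶β_) (subTyTm-renTm _ r t) β2
renTm-⟶β r (ξlam p)  = ξlam (renTm-⟶β (ext r) p)
renTm-⟶β r (ξapp₁ p) = ξapp₁ (renTm-⟶β r p)
renTm-⟶β r (ξapp₂ p) = ξapp₂ (renTm-⟶β r p)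
renTm-⟶β r (ξLam p)  = ξLam (renTm-⟶β r p)
renTm-⟶β r (ξtapp p) = ξtapp (renTm-⟶β r p)

wk-⟶β⁺ : a ⟶β⁺ b → wk a ⟶β⁺ wk b
wk-⟶β⁺ = map⁺ wk (renTm-⟶β suc)

wk-⟶β* : a ⟶β* b → wk a ⟶β* wk b
wk-⟶β* = gmap wk (renTm-⟶β suc)

mutual
  renSTy-* : (r : Fin n → Fin k) (A : SType n) → renSTy r A * ≡ renTTy r (A *)
  renSTy-* r (tv x)  = refl
  renSTy-* r (A ⊃ B) = cong₂ (λ b a → ¬ₜ b ⇒ ¬ₜ a) (renSTy-bar r B) (renSTy-bar r A)
  renSTy-* r (all A) = cong all (renSTy-bar (ext r) A)

  renSTy-bar : (r : Fin n → Fin k) (A : SType n) → bar (renSTy r A) ≡ renTTy r (bar A)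
  renSTy-bar r A = cong (λ a → top ⇒ ¬ₜ (¬ₜ a)) (renSTy-* r A)

extsTTy-* : {σ : Fin n → TType k} {σ' : Fin n → SType k} →
  (∀ i → σ i ≡ σ' i *) → ∀ i → extsTTy σ i ≡ extsSTy σ' i *
extsTTy-* h zero = refl
extsTTy-* {σ' = σ'} h (suc i) = trans (cong (renTTy suc) (h i)) (sym (renSTy-* suc (σ' i)))

mutual
  subSTy-* : {σ : Fin n → TType k} {σ' : Fin n → SType k} →
    (∀ i → σ i ≡ σ' i *) → (A : SType n) → subSTy σ' A * ≡ subTTy σ (A *)
  subSTy-* h (tv x)  = sym (h x)
  subSTy-* h (A ⊃ B) = cong₂ (λ b a → ¬ₜ b ⇒ ¬ₜ a) (subSTy-bar h B) (subSTy-bar h A)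
  subSTy-* h (all A) = cong all (subSTy-bar (extsTTy-* h) A)

  subSTy-bar : {σ : Fin n → TType k} {σ' : Fin n → SType k} →
    (∀ i → σ i ≡ σ' i *) → (A : SType n) → bar (subSTy σ' A) ≡ subTTy σ (bar A)
  subSTy-bar h A = cong (λ a → top ⇒ ¬ₜ (¬ₜ a)) (subSTy-* h A)

mutual
  subT-id : {θ : Fin m → STerm n m} → (∀ i → θ i ≡ var i) →
    (t : STerm n m) → subT θ t ≡ t
  subT-id h (var x)   = h x
  subT-id h (lam t)   = cong lam (subT-id (extsS-id h) t)
  subT-id h (Lam t)   = cong Lam (subT-id (cong (renTyT suc) ∘ h) t)
  subT-id h (brace c) = cong brace (subC-id h c)

  subL-id : {θ : Fin m → STerm n m} → (∀ i → θ i ≡ var i) →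
    (l : SCoterm n m) → subL θ l ≡ l
  subL-id h nil         = refl
  subL-id h (cons u l)  = cong₂ cons (subT-id h u) (subL-id h l)
  subL-id h (tcons B l) = cong (tcons B) (subL-id h l)
  subL-id h (mu c)      = cong mu (subC-id (extsS-id h) c)

  subC-id : {θ : Fin m → STerm n m} → (∀ i → θ i ≡ var i) →
    (c : SCmd n m) → subC θ c ≡ c
  subC-id h (cut t l) = cong₂ cut (subT-id h t) (subL-id h l)

  extsS-id : {θ : Fin m → STerm n m} → (∀ i → θ i ≡ var i) → ∀ i → extsS θ i ≡ var i
  extsS-id h zero    = refl
  extsS-id h (suc i) = cong (renT suc) (h i)

ext≗extsSTy : {r : Fin n → Fin k} {σ : Fin n → SType k} →
  (∀ i → tv (r i) ≡ σ i) → ∀ i → tv (ext r i) ≡ extsSTy σ i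
ext≗extsSTy h zero    = refl
ext≗extsSTy h (suc i) = cong (renSTy suc) (h i)

renSTy≗subSTy : {r : Fin n → Fin k} {σ : Fin n → SType k} →
  (∀ i → tv (r i) ≡ σ i) → (A : SType n) → renSTy r A ≡ subSTy σ A
renSTy≗subSTy h (tv x)  = h x
renSTy≗subSTy h (A ⊃ B) = cong₂ _⊃_ (renSTy≗subSTy h A) (renSTy≗subSTy h B)
renSTy≗subSTy h (all A) = cong all (renSTy≗subSTy (ext≗extsSTy h) A)

mutual
  renTyT≗subTyT : {r : Fin n → Fin k} {σ : Fin n → SType k} →
    (∀ i → tv (r i) ≡ σ i) → (t : STerm n m) → renTyT r t ≡ subTyT σ t
  renTyT≗subTyT h (var x)   = refl
  renTyT≗subTyT h (lam t)   = cong lam (renTyT≗subTyT h t)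
  renTyT≗subTyT h (Lam t)   = cong Lam (renTyT≗subTyT (ext≗extsSTy h) t)
  renTyT≗subTyT h (brace c) = cong brace (renTyC≗subTyC h c)

  renTyL≗subTyL : {r : Fin n → Fin k} {σ : Fin n → SType k} →
    (∀ i → tv (r i) ≡ σ i) → (l : SCoterm n m) → renTyL r l ≡ subTyL σ l
  renTyL≗subTyL h nil         = refl
  renTyL≗subTyL h (cons u l)  = cong₂ cons (renTyT≗subTyT h u) (renTyL≗subTyL h l)
  renTyL≗subTyL h (tcons B l) = cong₂ tcons (renSTy≗subSTy h B) (renTyL≗subTyL h l)
  renTyL≗subTyL h (mu c)      = cong mu (renTyC≗subTyC h c)

  renTyC≗subTyC : {r : Fin n → Fin k} {σ : Fin n → SType k} →
    (∀ i → tv (r i) ≡ σ i) → (c : SCmd n m) → renTyC r c ≡ subTyC σ c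
  renTyC≗subTyC h (cut t l) = cong₂ cut (renTyT≗subTyT h t) (renTyL≗subTyL h l)

IsEval-renL : (r : Fin m → Fin k) {E : SCoterm n m} → IsEval E → IsEval (renL r E)
IsEval-renL r evNil         = evNil
IsEval-renL r (evCons u l)  = evCons _ _
IsEval-renL r (evTCons B l) = evTCons _ _

wk-subTm : (τ : Fin m → Tm n k) {a : Tm n m} {b : Tm n k} → subTm τ a ≡ b →
  subTm (extsTm τ) (wk a) ≡ wk b
wk-subTm τ {a} e = trans (subTm-extsTm-wk τ a) (cong wk e)

wk-subTyTm : (σ : Fin n → TType n') {a : Tm n m} {b : Tm n' m} → subTyTm σ a ≡ b →
  subTyTm σ (wk a) ≡ wk b
wk-subTyTm σ {a} e = trans (subTyTm-renTm σ suc a) (cong wk e)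

wk²-subTm : (τ : Fin m → Tm n k) {a : Tm n m} {b : Tm n k} → subTm τ a ≡ b →
  subTm (extsTm (extsTm τ)) (wk (wk a)) ≡ wk (wk b)
wk²-subTm τ {a} e = wk-subTm (extsTm τ) {wk a} (wk-subTm τ {a} e)

wk²-subTyTm : (σ : Fin n → TType n') {a : Tm n m} {b : Tm n' m} → subTyTm σ a ≡ b →
  subTyTm σ (wk (wk a)) ≡ wk (wk b)
wk²-subTyTm σ {a} e = wk-subTyTm σ {wk a} (wk-subTyTm σ {a} e)

λ-apply-cong : {x x' y y' : Tm n (suc m)} → x ≡ x' → y ≡ y' →
  Tm.lam (var zero · x · y) ≡ lam (var zero · x' · y')
λ-apply-cong refl refl = refl

λ-tyapply-cong : {x x' : Tm n (suc m)} {A A' : TType n} → x ≡ x' → A ≡ A' →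
  Tm.lam (x · (var zero ·T A)) ≡ lam (x' · (var zero ·T A'))
λ-tyapply-cong refl refl = refl

-- Naturality and monotonicity of the translation

module Translation (s : Tm 0 0) where
  open CGPS s

  mutual
    trT-renT : {r : Fin m → Fin m'} {ρ : Fin m' → Fin k} {ρ' : Fin m → Fin k} →
      (∀ i → ρ (r i) ≡ ρ' i) → (t : STerm n m) (G K : Tm n k) →
      trT ρ (renT r t) G K ≡ trT ρ' t G K
    trT-renT h (var x)   G K = cong (λ v → var v · (embed s · G) · K) (h x)
    trT-renT h (lam t)   G K = cong (λ v → lam (wk K · lam (lam (var (suc zero) · v))) · G)
                                    (over-renT (ext-∘ (λ i → cong (λ j → suc (suc j)) (h i))) t)
    trT-renT h (Lam t)   G K = cong (λ v → lam (wk K · Lam v) · G)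
                                    (over-renT (λ i → cong suc (h i)) t)
    trT-renT h (brace c) G K = trC-renT h c (embed s · G) K

    over-renT : {r : Fin m → Fin m'} {ρ : Fin m' → Fin k} {ρ' : Fin m → Fin k} →
      (∀ i → ρ (r i) ≡ ρ' i) → (t : STerm n m) → over ρ (renT r t) ≡ over ρ' t
    over-renT h t = cong (λ b → lam (lam b))
      (trT-renT (λ i → cong (λ j → suc (suc j)) (h i)) t (var (suc zero)) (var zero))

    trL-renT : {r : Fin m → Fin m'} {ρ : Fin m' → Fin k} {ρ' : Fin m → Fin k} →
      (∀ i → ρ (r i) ≡ ρ' i) → (l : SCoterm n m) (G K : Tm n k) →
      trL ρ (renL r l) G K ≡ trL ρ' l G K
    trL-renT h nil         G K = refl
    trL-renT h (cons u l)  G K = λ-apply-cong refl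
      (λ-apply-cong (cong (wk ∘ wk) (trL-renT h l G K)) (cong (wk ∘ wk) (over-renT h u)))
    trL-renT h (tcons B l) G K =
      λ-apply-cong refl (λ-tyapply-cong (cong (wk ∘ wk) (trL-renT h l G K)) refl)
    trL-renT h (mu c)      G K = cong lam (trC-renT (ext-∘ h) c (wk G) (wk K))

    trC-renT : {r : Fin m → Fin m'} {ρ : Fin m' → Fin k} {ρ' : Fin m → Fin k} →
      (∀ i → ρ (r i) ≡ ρ' i) → (c : SCmd n m) (G K : Tm n k) →
      trC ρ (renC r c) G K ≡ trC ρ' c G K
    trC-renT h (cut t nil)         G K = trT-renT h t G K
    trC-renT h (cut t (cons u l))  G K = trans (trT-renT h t G _)
      (cong (trT _ t G) (λ-apply-cong (cong wk (trL-renT h l G K)) (cong wk (over-renT h u))))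
    trC-renT h (cut t (tcons B l)) G K = trans (trT-renT h t G _)
      (cong (trT _ t G) (λ-tyapply-cong (cong wk (trL-renT h l G K)) refl))
    trC-renT h (cut t (mu c))      G K = cong₂ _·_ (trL-renT h (mu c) G K) (over-renT h t)

  mutual
    subTm-trT : {τ : Fin k → Tm n k'} {ρ : Fin m → Fin k} {ρ' : Fin m → Fin k'} →
      (∀ i → τ (ρ i) ≡ var (ρ' i)) → (t : STerm n m) {G K : Tm n k} {G' K' : Tm n k'} →
      subTm τ G ≡ G' → subTm τ K ≡ K' → subTm τ (trT ρ t G K) ≡ trT ρ' t G' K'
    subTm-trT {τ = τ} h (var x) eG eK =
      cong₂ _·_ (cong₂ _·_ (h x) (cong₂ _·_ (subTm-embed τ s) eG)) eK
    subTm-trT {τ = τ} {ρ} {ρ'} h (lam t) {K = K} eG eK =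
      cong₂ _·_ (cong lam (cong₂ (λ k v → k · lam (lam (var (suc zero) · v)))
                                 (wk-subTm τ {K} eK) (subTm-over h³ t)))
                eG
      where h³ : ∀ i → extsTm (extsTm (extsTm τ)) (ext (λ i → suc (suc (ρ i))) i)
                         ≡ var (ext (λ i → suc (suc (ρ' i))) i)
            h³ zero    = refl
            h³ (suc i) = cong (wk ∘ wk ∘ wk) (h i)
    subTm-trT {τ = τ} h (Lam t) {K = K} eG eK =
      cong₂ _·_ (cong lam (cong₂ (λ k v → k · Lam v)
                                 (wk-subTm τ {K} eK) (subTm-over (cong (renTyTm suc ∘ wk) ∘ h) t)))
                eG
    subTm-trT {τ = τ} h (brace c) eG eK = subTm-trC h c (cong₂ _·_ (subTm-embed τ s) eG) eK

    subTm-over : {τ : Fin k → Tm n k'} {ρ : Fin m → Fin k} {ρ' : Fin m → Fin k'} →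
      (∀ i → τ (ρ i) ≡ var (ρ' i)) → (t : STerm n m) → subTm τ (over ρ t) ≡ over ρ' t
    subTm-over h t = cong (λ b → lam (lam b)) (subTm-trT (cong (wk ∘ wk) ∘ h) t refl refl)

    subTm-trL : {τ : Fin k → Tm n k'} {ρ : Fin m → Fin k} {ρ' : Fin m → Fin k'} →
      (∀ i → τ (ρ i) ≡ var (ρ' i)) → (l : SCoterm n m) {G K : Tm n k} {G' K' : Tm n k'} →
      subTm τ G ≡ G' → subTm τ K ≡ K' → subTm τ (trL ρ l G K) ≡ trL ρ' l G' K'
    subTm-trL {τ = τ} h nil {G} {K} eG eK = λ-apply-cong (wk-subTm τ {G} eG) (wk-subTm τ {K} eK)
    subTm-trL {τ = τ} {ρ} h (cons u l) {G} {K} eG eK = λ-apply-cong (wk-subTm τ {G} eG)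
      (λ-apply-cong (wk²-subTm τ {trL ρ l G K} (subTm-trL h l eG eK))
                    (wk²-subTm τ {over ρ u} (subTm-over h u)))
    subTm-trL {τ = τ} {ρ} h (tcons B l) {G} {K} eG eK = λ-apply-cong (wk-subTm τ {G} eG)
      (λ-tyapply-cong (wk²-subTm τ {trL ρ l G K} (subTm-trL h l eG eK)) refl)
    subTm-trL {τ = τ} {ρ} {ρ'} h (mu c) {G} {K} eG eK =
      cong lam (subTm-trC h⁺ c (wk-subTm τ {G} eG) (wk-subTm τ {K} eK))
      where h⁺ : ∀ i → extsTm τ (ext ρ i) ≡ var (ext ρ' i)
            h⁺ zero    = refl
            h⁺ (suc i) = cong wk (h i)

    subTm-trC : {τ : Fin k → Tm n k'} {ρ : Fin m → Fin k} {ρ' : Fin m → Fin k'} →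
      (∀ i → τ (ρ i) ≡ var (ρ' i)) → (c : SCmd n m) {G K : Tm n k} {G' K' : Tm n k'} →
      subTm τ G ≡ G' → subTm τ K ≡ K' → subTm τ (trC ρ c G K) ≡ trC ρ' c G' K'
    subTm-trC h (cut t nil) eG eK = subTm-trT h t eG eK
    subTm-trC {τ = τ} {ρ} h (cut t (cons u l)) {G} {K} eG eK = subTm-trT h t eG
      (λ-apply-cong (wk-subTm τ {trL ρ l G K} (subTm-trL h l eG eK))
                    (wk-subTm τ {over ρ u} (subTm-over h u)))
    subTm-trC {τ = τ} {ρ} h (cut t (tcons B l)) {G} {K} eG eK = subTm-trT h t eG
      (λ-tyapply-cong (wk-subTm τ {trL ρ l G K} (subTm-trL h l eG eK)) refl)
    subTm-trC h (cut t (mu c)) eG eK = cong₂ _·_ (subTm-trL h (mu c) eG eK) (subTm-over h t)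

  renTm-trL : (r : Fin k → Fin k') {ρ : Fin m → Fin k} {ρ' : Fin m → Fin k'} →
    (∀ i → r (ρ i) ≡ ρ' i) → (l : SCoterm n m) (G K : Tm n k) →
    renTm r (trL ρ l G K) ≡ trL ρ' l (renTm r G) (renTm r K)
  renTm-trL r h l G K = trans (renTm≗subTm (λ _ → refl) _)
    (subTm-trL (cong var ∘ h) l (sym (renTm≗subTm (λ _ → refl) G))
                                 (sym (renTm≗subTm (λ _ → refl) K)))

  renTm-over : (r : Fin k → Fin k') {ρ : Fin m → Fin k} {ρ' : Fin m → Fin k'} →
    (∀ i → r (ρ i) ≡ ρ' i) → (t : STerm n m) → renTm r (over ρ t) ≡ over ρ' t
  renTm-over r h t = trans (renTm≗subTm (λ _ → refl) _) (subTm-over (cong var ∘ h) t)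

  trL-wk : (ρ : Fin m → Fin k) (l : SCoterm n m) (G K : Tm n k) →
    trL (ext ρ) (renL suc l) (wk G) (wk K) ≡ wk (trL ρ l G K)
  trL-wk ρ l G K =
    trans (trL-renT (λ _ → refl) l (wk G) (wk K)) (sym (renTm-trL suc (λ _ → refl) l G K))

  over-wk : (ρ : Fin m → Fin k) (t : STerm n m) → over (ext ρ) (renT suc t) ≡ wk (over ρ t)
  over-wk ρ t = trans (over-renT (λ _ → refl) t) (sym (renTm-over suc (λ _ → refl) t))

  mutual
    subTyTm-trT : {σ : Fin n → TType n'} {σ' : Fin n → SType n'} {ρ : Fin m → Fin k} →
      (∀ i → σ i ≡ σ' i *) → (t : STerm n m) {G K : Tm n k} {G' K' : Tm n' k} →
      subTyTm σ G ≡ G' → subTyTm σ K ≡ K' →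
      subTyTm σ (trT ρ t G K) ≡ trT ρ (subTyT σ' t) G' K'
    subTyTm-trT {σ = σ} {ρ = ρ} h (var x) eG eK =
      cong₂ _·_ (cong (var (ρ x) ·_) (cong₂ _·_ (subTyTm-embed σ s) eG)) eK
    subTyTm-trT {σ = σ} h (lam t) {K = K} eG eK =
      cong₂ _·_ (cong lam (cong₂ (λ k v → k · lam (lam (var (suc zero) · v)))
                                 (wk-subTyTm σ {K} eK) (subTyTm-over h t)))
                eG
    subTyTm-trT {σ = σ} h (Lam t) {K = K} eG eK =
      cong₂ _·_ (cong lam (cong₂ (λ k v → k · Lam v)
                                 (wk-subTyTm σ {K} eK) (subTyTm-over (extsTTy-* h) t)))
                eG
    subTyTm-trT {σ = σ} h (brace c) eG eK = subTyTm-trC h c (cong₂ _·_ (subTyTm-embed σ s) eG) eK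

    subTyTm-over : {σ : Fin n → TType n'} {σ' : Fin n → SType n'} {ρ : Fin m → Fin k} →
      (∀ i → σ i ≡ σ' i *) → (t : STerm n m) → subTyTm σ (over ρ t) ≡ over ρ (subTyT σ' t)
    subTyTm-over h t = cong (λ b → lam (lam b)) (subTyTm-trT h t refl refl)

    subTyTm-trL : {σ : Fin n → TType n'} {σ' : Fin n → SType n'} {ρ : Fin m → Fin k} →
      (∀ i → σ i ≡ σ' i *) → (l : SCoterm n m) {G K : Tm n k} {G' K' : Tm n' k} →
      subTyTm σ G ≡ G' → subTyTm σ K ≡ K' →
      subTyTm σ (trL ρ l G K) ≡ trL ρ (subTyL σ' l) G' K'
    subTyTm-trL {σ = σ} h nil {G} {K} eG eK =
      λ-apply-cong (wk-subTyTm σ {G} eG) (wk-subTyTm σ {K} eK)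
    subTyTm-trL {σ = σ} {ρ = ρ} h (cons u l) {G} {K} eG eK = λ-apply-cong (wk-subTyTm σ {G} eG)
      (λ-apply-cong (wk²-subTyTm σ {trL ρ l G K} (subTyTm-trL h l eG eK))
                    (wk²-subTyTm σ {over ρ u} (subTyTm-over h u)))
    subTyTm-trL {σ = σ} {ρ = ρ} h (tcons B l) {G} {K} eG eK = λ-apply-cong (wk-subTyTm σ {G} eG)
      (λ-tyapply-cong (wk²-subTyTm σ {trL ρ l G K} (subTyTm-trL h l eG eK)) (sym (subSTy-* h B)))
    subTyTm-trL {σ = σ} h (mu c) {G} {K} eG eK =
      cong lam (subTyTm-trC h c (wk-subTyTm σ {G} eG) (wk-subTyTm σ {K} eK))

    subTyTm-trC : {σ : Fin n → TType n'} {σ' : Fin n → SType n'} {ρ : Fin m → Fin k} →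
      (∀ i → σ i ≡ σ' i *) → (c : SCmd n m) {G K : Tm n k} {G' K' : Tm n' k} →
      subTyTm σ G ≡ G' → subTyTm σ K ≡ K' →
      subTyTm σ (trC ρ c G K) ≡ trC ρ (subTyC σ' c) G' K'
    subTyTm-trC h (cut t nil) eG eK = subTyTm-trT h t eG eK
    subTyTm-trC {σ = σ} {ρ = ρ} h (cut t (cons u l)) {G} {K} eG eK = subTyTm-trT h t eG
      (λ-apply-cong (wk-subTyTm σ {trL ρ l G K} (subTyTm-trL h l eG eK))
                    (wk-subTyTm σ {over ρ u} (subTyTm-over h u)))
    subTyTm-trC {σ = σ} {ρ = ρ} h (cut t (tcons B l)) {G} {K} eG eK = subTyTm-trT h t eG
      (λ-tyapply-cong (wk-subTyTm σ {trL ρ l G K} (subTyTm-trL h l eG eK)) (sym (subSTy-* h B)))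
    subTyTm-trC h (cut t (mu c)) eG eK = cong₂ _·_ (subTyTm-trL h (mu c) eG eK) (subTyTm-over h t)

  renTyTm-over : (r : Fin n → Fin n') {ρ : Fin m → Fin k} (t : STerm n m) →
    renTyTm r (over ρ t) ≡ over ρ (renTyT r t)
  renTyTm-over r t =
    trans (renTyTm≗subTyTm (λ _ → refl) _)
          (trans (subTyTm-over (λ _ → refl) t)
                 (cong (over _) (sym (renTyT≗subTyT (λ _ → refl) t))))

  mutual
    trT-reduceK : (ρ : Fin m → Fin k) (t : STerm n m) (G : Tm n k) {K K' : Tm n k} →
      K ⟶β K' → trT ρ t G K ⟶β⁺ trT ρ t G K'
    trT-reduceK ρ (var x)   G p = [ ξapp₂ p ]
    trT-reduceK ρ (lam t)   G p = [ ξapp₁ (ξlam (ξapp₁ (renTm-⟶β suc p))) ]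
    trT-reduceK ρ (Lam t)   G p = [ ξapp₁ (ξlam (ξapp₁ (renTm-⟶β suc p))) ]
    trT-reduceK ρ (brace c) G p = trC-reduceK ρ c (embed s · G) p

    trL-reduceK : (ρ : Fin m → Fin k) (l : SCoterm n m) (G : Tm n k) {K K' : Tm n k} →
      K ⟶β K' → trL ρ l G K ⟶β⁺ trL ρ l G K'
    trL-reduceK ρ nil         G p = [ ξlam (ξapp₂ (renTm-⟶β suc p)) ]
    trL-reduceK ρ (cons u l)  G p =
      lam⁺ (app₂⁺ (lam⁺ (app₁⁺ (app₂⁺ (wk-⟶β⁺ (wk-⟶β⁺ (trL-reduceK ρ l G p)))))))
    trL-reduceK ρ (tcons B l) G p =
      lam⁺ (app₂⁺ (lam⁺ (app₁⁺ (wk-⟶β⁺ (wk-⟶β⁺ (trL-reduceK ρ l G p))))))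
    trL-reduceK ρ (mu c)      G p = lam⁺ (trC-reduceK (ext ρ) c (wk G) (renTm-⟶β suc p))

    trC-reduceK : (ρ : Fin m → Fin k) (c : SCmd n m) (G : Tm n k) {K K' : Tm n k} →
      K ⟶β K' → trC ρ c G K ⟶β⁺ trC ρ c G K'
    trC-reduceK ρ (cut t nil)         G p = trT-reduceK ρ t G p
    trC-reduceK ρ (cut t (cons u l))  G p =
      trT-reduceK⁺ ρ t G (lam⁺ (app₁⁺ (app₂⁺ (wk-⟶β⁺ (trL-reduceK ρ l G p)))))
    trC-reduceK ρ (cut t (tcons B l)) G p =
      trT-reduceK⁺ ρ t G (lam⁺ (app₁⁺ (wk-⟶β⁺ (trL-reduceK ρ l G p))))
    trC-reduceK ρ (cut t (mu c))      G p = app₁⁺ (trL-reduceK ρ (mu c) G p)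

    trT-reduceK⁺ : (ρ : Fin m → Fin k) (t : STerm n m) (G : Tm n k) {K K' : Tm n k} →
      K ⟶β⁺ K' → trT ρ t G K ⟶β⁺ trT ρ t G K'
    trT-reduceK⁺ ρ t G [ p ]    = trT-reduceK ρ t G p
    trT-reduceK⁺ ρ t G (p ∷ ps) = trT-reduceK ρ t G p ++ trT-reduceK⁺ ρ t G ps

  trT-reduceK* : (ρ : Fin m → Fin k) (t : STerm n m) (G : Tm n k) {K K' : Tm n k} →
    K ⟶β* K' → trT ρ t G K ⟶β* trT ρ t G K'
  trT-reduceK* ρ t G = bind* (trT ρ t G) (trT-reduceK ρ t G)

  mutual
    trT-reduceG : (ρ : Fin m → Fin k) (t : STerm n m) (K : Tm n k) {G G' : Tm n k} →
      G ⟶β G' → trT ρ t G K ⟶β⁺ trT ρ t G' K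
    trT-reduceG ρ (var x)   K p = [ ξapp₁ (ξapp₂ (ξapp₂ p)) ]
    trT-reduceG ρ (lam t)   K p = [ ξapp₂ p ]
    trT-reduceG ρ (Lam t)   K p = [ ξapp₂ p ]
    trT-reduceG ρ (brace c) K p = trC-reduceG ρ c K (ξapp₂ p)

    trL-reduceG : (ρ : Fin m → Fin k) (l : SCoterm n m) (K : Tm n k) {G G' : Tm n k} →
      G ⟶β G' → trL ρ l G K ⟶β⁺ trL ρ l G' K
    trL-reduceG ρ nil         K p = [ ξlam (ξapp₁ (ξapp₂ (renTm-⟶β suc p))) ]
    trL-reduceG ρ (cons u l)  K p = lam⁺ (ξapp₁ (ξapp₂ (renTm-⟶β suc p)) ∷
      app₂⁺ (lam⁺ (app₁⁺ (app₂⁺ (wk-⟶β⁺ (wk-⟶β⁺ (trL-reduceG ρ l K p)))))))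
    trL-reduceG ρ (tcons B l) K p = lam⁺ (ξapp₁ (ξapp₂ (renTm-⟶β suc p)) ∷
      app₂⁺ (lam⁺ (app₁⁺ (wk-⟶β⁺ (wk-⟶β⁺ (trL-reduceG ρ l K p))))))
    trL-reduceG ρ (mu c)      K p = lam⁺ (trC-reduceG (ext ρ) c (wk K) (renTm-⟶β suc p))

    trC-reduceG : (ρ : Fin m → Fin k) (c : SCmd n m) (K : Tm n k) {G G' : Tm n k} →
      G ⟶β G' → trC ρ c G K ⟶β⁺ trC ρ c G' K
    trC-reduceG ρ (cut t nil)         K p = trT-reduceG ρ t K p
    trC-reduceG ρ (cut t (cons u l))  K p = trT-reduceG ρ t _ p ++
      trT-reduceK⁺ ρ t _ (lam⁺ (app₁⁺ (app₂⁺ (wk-⟶β⁺ (trL-reduceG ρ l K p)))))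
    trC-reduceG ρ (cut t (tcons B l)) K p = trT-reduceG ρ t _ p ++
      trT-reduceK⁺ ρ t _ (lam⁺ (app₁⁺ (wk-⟶β⁺ (trL-reduceG ρ l K p))))
    trC-reduceG ρ (cut t (mu c))      K p = app₁⁺ (trL-reduceG ρ (mu c) K p)

  trT-reduceG⁺ : (ρ : Fin m → Fin k) (t : STerm n m) (K : Tm n k) {G G' : Tm n k} →
    G ⟶β⁺ G' → trT ρ t G K ⟶β⁺ trT ρ t G' K
  trT-reduceG⁺ ρ t K = bind⁺ (λ G → trT ρ t G K) (trT-reduceG ρ t K)

  trC-reduceG⁺ : (ρ : Fin m → Fin k) (c : SCmd n m) (K : Tm n k) {G G' : Tm n k} →
    G ⟶β⁺ G' → trC ρ c G K ⟶β⁺ trC ρ c G' K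
  trC-reduceG⁺ ρ c K = bind⁺ (λ G → trC ρ c G K) (trC-reduceG ρ c K)

  over-applied : (ρ : Fin m → Fin k) (t : STerm n m) (G K : Tm n k) →
    over ρ t · G · K ⟶β⁺ trT ρ t G K
  over-applied ρ t G K = ξapp₁ (β-step bind-g) ∷ [ β-step bind-k ]
    where
      bind-g : ∀ {σ} → IsSub₀ σ G →
        subTm σ (lam (trT (λ i → suc (suc (ρ i))) t (var (suc zero)) (var zero)))
          ≡ lam (trT (λ i → suc (ρ i)) t (wk G) (var zero))
      bind-g (σ-zero , σ-suc) =
        cong lam (subTm-trT (λ i → cong wk (σ-suc (ρ i))) t (cong wk σ-zero) refl)

      bind-k : ∀ {σ} → IsSub₀ σ K →
        subTm σ (trT (λ i → suc (ρ i)) t (wk G) (var zero)) ≡ trT ρ t G K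
      bind-k (σ-zero , σ-suc) = subTm-trT (λ i → σ-suc (ρ i)) t (subTm-wk σ-suc G) σ-zero

  trL-applied : (ρ : Fin m → Fin k) (l : SCoterm n m) (t : STerm n m) (G K : Tm n k) →
    trL ρ l G K · over ρ t ⟶β* trC ρ (cut t l) G K
  trL-applied ρ nil t G K = β-step e ◅ ⁺⇒* (over-applied ρ t G K)
    where
      e : ∀ {σ} → IsSub₀ σ (over ρ t) → subTm σ (var zero · wk G · wk K) ≡ over ρ t · G · K
      e (σ-zero , σ-suc) = cong₂ _·_ (cong₂ _·_ σ-zero (subTm-wk σ-suc G)) (subTm-wk σ-suc K)
  trL-applied ρ (cons u l) t G K = β-step e ◅ ⁺⇒* (over-applied ρ t G _)
    where
      L = trL ρ l G K
      U = over ρ u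
      e : ∀ {σ} → IsSub₀ σ (over ρ t) →
        subTm σ (var zero · wk G · lam (var zero · wk (wk L) · wk (wk U)))
          ≡ over ρ t · G · lam (var zero · wk L · wk U)
      e {σ} (σ-zero , σ-suc) = cong₂ _·_ (cong₂ _·_ σ-zero (subTm-wk σ-suc G))
        (λ-apply-cong (wk-subTm σ {wk L} (subTm-wk σ-suc L)) (wk-subTm σ {wk U} (subTm-wk σ-suc U)))
  trL-applied ρ (tcons B l) t G K = β-step e ◅ ⁺⇒* (over-applied ρ t G _)
    where
      L = trL ρ l G K
      e : ∀ {σ} → IsSub₀ σ (over ρ t) →
        subTm σ (var zero · wk G · lam (wk (wk L) · (var zero ·T (B *))))
          ≡ over ρ t · G · lam (wk L · (var zero ·T (B *)))
      e {σ} (σ-zero , σ-suc) = cong₂ _·_ (cong₂ _·_ σ-zero (subTm-wk σ-suc G))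
        (λ-tyapply-cong (wk-subTm σ {wk L} (subTm-wk σ-suc L)) refl)
  trL-applied ρ (mu c) t G K = ε

  -- An evaluation context enters the translation only through this continuation.
  cont : (ρ : Fin m → Fin k) {E : SCoterm n m} → IsEval E → Tm n k → Tm n k → Tm n k
  cont ρ evNil         G K = K
  cont ρ (evCons u l)  G K = lam (var zero · wk (trL ρ l G K) · wk (over ρ u))
  cont ρ (evTCons B l) G K = lam (wk (trL ρ l G K) · (var zero ·T (B *)))

  trC-IsEval : (ρ : Fin m → Fin k) {E : SCoterm n m} (ev : IsEval E) (t : STerm n m) (G K : Tm n k) →
    trC ρ (cut t E) G K ≡ trT ρ t G (cont ρ ev G K)
  trC-IsEval ρ evNil         t G K = refl
  trC-IsEval ρ (evCons u l)  t G K = refl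
  trC-IsEval ρ (evTCons B l) t G K = refl

  trL-IsEval : (ρ : Fin m → Fin k) {E : SCoterm n m} (ev : IsEval E) (G K : Tm n k) →
    trL ρ E G K ≡ lam (var zero · wk G · wk (cont ρ ev G K))
  trL-IsEval ρ evNil         G K = refl
  trL-IsEval ρ (evCons u l)  G K = λ-apply-cong refl
    (λ-apply-cong (sym (renTm-ext-wk (trL ρ l G K))) (sym (renTm-ext-wk (over ρ u))))
  trL-IsEval ρ (evTCons B l) G K = λ-apply-cong refl
    (λ-tyapply-cong (sym (renTm-ext-wk (trL ρ l G K))) refl)

  wk-cont : (ρ : Fin m → Fin k) {E : SCoterm n m} (ev : IsEval E) (G K : Tm n k) →
    wk (cont ρ ev G K) ≡ cont (ext ρ) (IsEval-renL suc ev) (wk G) (wk K)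
  wk-cont ρ evNil         G K = refl
  wk-cont ρ (evCons u l)  G K = λ-apply-cong
    (trans (renTm-ext-wk (trL ρ l G K)) (cong wk (sym (trL-wk ρ l G K))))
    (trans (renTm-ext-wk (over ρ u)) (cong wk (sym (over-wk ρ u))))
  wk-cont ρ (evTCons B l) G K = λ-tyapply-cong
    (trans (renTm-ext-wk (trL ρ l G K)) (cong wk (sym (trL-wk ρ l G K)))) refl

  mutual
    trC-++L : (ρ : Fin m → Fin k) {E : SCoterm n m} (ev : IsEval E) (t : STerm n m)
      (l : SCoterm n m) (G K : Tm n k) →
      trC ρ (cut t l) G (cont ρ ev G K) ≡ trC ρ (cut t (l ++L E)) G K
    trC-++L ρ ev t nil         G K = sym (trC-IsEval ρ ev t G K)
    trC-++L ρ ev t (cons u l)  G K =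
      cong (trT ρ t G) (λ-apply-cong (cong wk (trL-++L ρ ev l G K)) refl)
    trC-++L ρ ev t (tcons B l) G K =
      cong (trT ρ t G) (λ-tyapply-cong (cong wk (trL-++L ρ ev l G K)) refl)
    trC-++L ρ ev t (mu (cut t' l')) G K = cong (_· over ρ t) (trL-++L ρ ev (mu (cut t' l')) G K)

    trL-++L : (ρ : Fin m → Fin k) {E : SCoterm n m} (ev : IsEval E) (l : SCoterm n m)
      (G K : Tm n k) → trL ρ l G (cont ρ ev G K) ≡ trL ρ (l ++L E) G K
    trL-++L ρ ev nil         G K = sym (trL-IsEval ρ ev G K)
    trL-++L ρ ev (cons u l)  G K =
      λ-apply-cong refl (λ-apply-cong (cong (wk ∘ wk) (trL-++L ρ ev l G K)) refl)
    trL-++L ρ ev (tcons B l) G K =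
      λ-apply-cong refl (λ-tyapply-cong (cong (wk ∘ wk) (trL-++L ρ ev l G K)) refl)
    trL-++L ρ ev (mu (cut t l)) G K = cong lam
      (trans (cong (trC (ext ρ) (cut t l) (wk G)) (wk-cont ρ ev G K))
             (trC-++L (ext ρ) (IsEval-renL suc ev) t l (wk G) (wk K)))

  record Realizes (θ : Fin m → STerm n m') (ρ : Fin m → Fin k) (τ : Fin k → Tm n k')
                  (ρ' : Fin m' → Fin k') : Set where
    constructor realizes
    field
      realize : ∀ i → (∃[ j ] θ i ≡ var j × τ (ρ i) ≡ var (ρ' j)) ⊎ τ (ρ i) ≡ over ρ' (θ i)
  open Realizes

  Realizes-wk : Realizes θ ρ τ ρ' → Realizes θ (λ i → suc (ρ i)) (extsTm τ) (λ j → suc (ρ' j))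
  Realizes-wk {θ = θ} g = realizes λ i →
    ⊎-map (λ (j , θi≡j , τρi≡j) → j , θi≡j , cong wk τρi≡j)
          (λ e → trans (cong wk e) (renTm-over suc (λ _ → refl) (θ i))) (realize g i)

  Realizes-ext : Realizes θ ρ τ ρ' → Realizes (extsS θ) (ext ρ) (extsTm τ) (ext ρ')
  Realizes-ext {θ = θ} {ρ' = ρ'} g = realizes λ where
    zero    → inj₁ (zero , refl , refl)
    (suc i) → ⊎-map (λ (j , θi≡j , τρi≡j) → suc j , cong (renT suc) θi≡j , cong wk τρi≡j)
                    (λ e → trans (cong wk e) (sym (over-wk ρ' (θ i)))) (realize g i)

  Realizes-renTy : Realizes θ ρ τ ρ' → Realizes (renTyT suc ∘ θ) ρ (renTyTm suc ∘ τ) ρ'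
  Realizes-renTy {θ = θ} g = realizes λ i →
    ⊎-map (λ (j , θi≡j , τρi≡j) → j , cong (renTyT suc) θi≡j , cong (renTyTm suc) τρi≡j)
          (λ e → trans (cong (renTyTm suc) e) (renTyTm-over suc (θ i))) (realize g i)

-- Simulation

module Simulation (s : Tm 0 0) (hs : {n m : ℕ} (G : Tm n m) → embed s · G ⟶β⁺ G) where
  open CGPS s
  open Translation s
  open Realizes

  -- A variable replaced by a term u becomes ū G⁺ K, which only reduces to
  -- (u : G, K), through (u : G⁺, K) and hs; hence ⟶β* rather than equality.
  mutual
    trT-subst : Realizes θ ρ τ ρ' → (t : STerm n m) {G K : Tm n k} {G' K' : Tm n k'} →
      subTm τ G ≡ G' → subTm τ K ≡ K' → subTm τ (trT ρ t G K) ⟶β* trT ρ' (subT θ t) G' K'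
    trT-subst {θ = θ} {τ = τ} {ρ' = ρ'} g (var x) {G' = G'} {K'} eG eK with realize g x
    ... | inj₁ (j , θx≡j , τρx≡j) rewrite θx≡j =
      ≡⇒* (cong₂ _·_ (cong₂ _·_ τρx≡j (cong₂ _·_ (subTm-embed τ s) eG)) eK)
    ... | inj₂ τρx≡θx =
      ≡⇒* (cong₂ _·_ (cong₂ _·_ τρx≡θx (cong₂ _·_ (subTm-embed τ s) eG)) eK) ◅◅
      ⁺⇒* (over-applied ρ' (θ x) (embed s · G') K' ++ trT-reduceG⁺ ρ' (θ x) K' (hs G'))
    trT-subst {τ = τ} g (lam t) {K = K} eG eK =
      app* (lam* (app* (≡⇒* (wk-subTm τ {K} eK))
                       (lam* (lam* (app₂* (over-subst (Realizes-ext (Realizes-wk (Realizes-wk g))) t))))))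
           (≡⇒* eG)
    trT-subst {τ = τ} g (Lam t) {K = K} eG eK =
      app* (lam* (app* (≡⇒* (wk-subTm τ {K} eK))
                       (Lam* (over-subst (Realizes-renTy (Realizes-wk g)) t))))
           (≡⇒* eG)
    trT-subst {τ = τ} g (brace c) eG eK = trC-subst g c (cong₂ _·_ (subTm-embed τ s) eG) eK

    over-subst : Realizes θ ρ τ ρ' → (t : STerm n m) →
      subTm τ (over ρ t) ⟶β* over ρ' (subT θ t)
    over-subst g t = lam* (lam* (trT-subst (Realizes-wk (Realizes-wk g)) t refl refl))

    trL-subst : Realizes θ ρ τ ρ' → (l : SCoterm n m) {G K : Tm n k} {G' K' : Tm n k'} →
      subTm τ G ≡ G' → subTm τ K ≡ K' → subTm τ (trL ρ l G K) ⟶β* trL ρ' (subL θ l) G' K'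
    trL-subst {τ = τ} g nil {G} {K} eG eK =
      ≡⇒* (λ-apply-cong (wk-subTm τ {G} eG) (wk-subTm τ {K} eK))
    trL-subst {ρ = ρ} {τ = τ} g (cons u l) {G} {K} eG eK =
      lam* (app₂* (lam* (app*
        (app₂* (≡⇒* (wk²-subTm τ {trL ρ l G K} refl) ◅◅
                wk-⟶β* (wk-⟶β* (trL-subst g l eG eK))))
        (≡⇒* (wk²-subTm τ {over ρ u} refl) ◅◅ wk-⟶β* (wk-⟶β* (over-subst g u))))))
      ◅◅ ≡⇒* (λ-apply-cong (wk-subTm τ {G} eG) refl)
    trL-subst {ρ = ρ} {τ = τ} g (tcons B l) {G} {K} eG eK =
      lam* (app₂* (lam* (app₁*
        (≡⇒* (wk²-subTm τ {trL ρ l G K} refl) ◅◅ wk-⟶β* (wk-⟶β* (trL-subst g l eG eK))))))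
      ◅◅ ≡⇒* (λ-apply-cong (wk-subTm τ {G} eG) refl)
    trL-subst {τ = τ} g (mu c) {G} {K} eG eK =
      lam* (trC-subst (Realizes-ext g) c (wk-subTm τ {G} eG) (wk-subTm τ {K} eK))

    trC-subst : Realizes θ ρ τ ρ' → (c : SCmd n m) {G K : Tm n k} {G' K' : Tm n k'} →
      subTm τ G ≡ G' → subTm τ K ≡ K' → subTm τ (trC ρ c G K) ⟶β* trC ρ' (subC θ c) G' K'
    trC-subst g (cut t nil) eG eK = trT-subst g t eG eK
    trC-subst {θ = θ} {ρ = ρ} {τ = τ} {ρ' = ρ'} g (cut t (cons u l)) {G} {K} {G'} eG eK =
      trT-subst g t eG refl ◅◅ trT-reduceK* ρ' (subT θ t) G'
        (lam* (app* (app₂* (≡⇒* (wk-subTm τ {trL ρ l G K} refl) ◅◅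
                            wk-⟶β* (trL-subst g l eG eK)))
                    (≡⇒* (wk-subTm τ {over ρ u} refl) ◅◅ wk-⟶β* (over-subst g u))))
    trC-subst {θ = θ} {ρ = ρ} {τ = τ} {ρ' = ρ'} g (cut t (tcons B l)) {G} {K} {G'} eG eK =
      trT-subst g t eG refl ◅◅ trT-reduceK* ρ' (subT θ t) G'
        (lam* (app₁* (≡⇒* (wk-subTm τ {trL ρ l G K} refl) ◅◅ wk-⟶β* (trL-subst g l eG eK))))
    trC-subst g (cut t (mu c)) eG eK = app* (trL-subst g (mu c) eG eK) (over-subst g t)

  trL-μ : (ρ : Fin m → Fin k) (l : SCoterm n m) (G K : Tm n k) →
    trL ρ (mu (cut (var zero) (renL suc l))) G K ⟶β⁺ trL ρ l G K
  trL-μ ρ nil         G K = lam⁺ (app₁⁺ (app₂⁺ (hs (wk G))))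
  trL-μ ρ (cons u l)  G K = lam⁺ (app₁⁺ (app₂⁺ (hs (wk G)))) ⁺≡
    λ-apply-cong refl (λ-apply-cong (cong wk (trL-wk ρ l G K)) (cong wk (over-wk ρ u)))
  trL-μ ρ (tcons B l) G K = lam⁺ (app₁⁺ (app₂⁺ (hs (wk G)))) ⁺≡
    λ-apply-cong refl (λ-tyapply-cong (cong wk (trL-wk ρ l G K)) refl)
  trL-μ {m = m} {k = k} ρ (mu c) G K = lam⁺ (β-steps λ {σ} (σ-zero , σ-suc) →
    ≡⇒* (cong (subTm σ) (trC-renT ext²-∘-ext c (wk (wk G)) (wk (wk K)))) ◅◅
    trC-subst (var-realized σ-zero σ-suc) c (subTm-wk σ-suc (wk G)) (subTm-wk σ-suc (wk K)) ◅◅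
    ≡⇒* (cong (λ c' → trC (ext ρ) c' (wk G) (wk K)) (subC-id (λ _ → refl) c)))
    where
      ρ⁺ : Fin (suc m) → Fin (suc (suc k))
      ρ⁺ zero    = zero
      ρ⁺ (suc i) = suc (suc (ρ i))

      ext²-∘-ext : ∀ i → ext (ext ρ) (ext suc i) ≡ ρ⁺ i
      ext²-∘-ext zero    = refl
      ext²-∘-ext (suc i) = refl

      var-realized : ∀ {σ} → σ zero ≡ over (ext ρ) (var zero) → (∀ i → σ (suc i) ≡ var i) →
        Realizes STerm.var ρ⁺ σ (ext ρ)
      var-realized σ-zero σ-suc = realizes λ where
        zero    → inj₂ σ-zero
        (suc i) → inj₁ (suc i , refl , σ-suc (suc (ρ i)))

  trC-β : (ρ : Fin m → Fin k) (t : STerm n (suc m)) (u : STerm n m) (l : SCoterm n m)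
    (G K : Tm n k) →
    trC ρ (cut (lam t) (cons u l)) G K ⟶β⁺ trC ρ (cut u (mu (cut t (renL suc l)))) G K
  trC-β ρ t u l G K =
    β-step bind-g ∷ β-step bind-k ∷ [ ξapp₁ (β-step bind-l) ] ⁺◅◅
      app₁* (lam* (≡⇒* (cong (_· over (ext ρ) t) (sym (trL-wk ρ l G K))) ◅◅
                   trL-applied (ext ρ) (renL suc l) t (wk G) (wk K)))
    where
      L  = trL ρ l G K
      U  = over ρ u
      K₁ = lam (var zero · wk L · wk U)
      Λt = lam (lam (var (suc zero) · over (ext (λ i → suc (ρ i))) t))

      bind-g : ∀ {σ} → IsSub₀ σ G →
        subTm σ (wk K₁ · lam (lam (var (suc zero) · over (ext (λ i → suc (suc (ρ i)))) t)))
          ≡ K₁ · Λt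
      bind-g {σ} (σ-zero , σ-suc) =
        cong₂ _·_ (subTm-wk σ-suc K₁)
                  (cong (λ v → lam (lam (var (suc zero) · v))) (subTm-over shift t))
        where shift : ∀ i → extsTm (extsTm σ) (ext (λ i → suc (suc (ρ i))) i)
                              ≡ var (ext (λ i → suc (ρ i)) i)
              shift zero    = refl
              shift (suc i) = cong (wk ∘ wk) (σ-suc (ρ i))

      bind-k : ∀ {σ} → IsSub₀ σ Λt → subTm σ (var zero · wk L · wk U) ≡ Λt · L · U
      bind-k (σ-zero , σ-suc) = cong₂ _·_ (cong₂ _·_ σ-zero (subTm-wk σ-suc L)) (subTm-wk σ-suc U)

      bind-l : ∀ {σ} → IsSub₀ σ L →
        subTm σ (lam (var (suc zero) · over (ext (λ i → suc (ρ i))) t))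
          ≡ lam (wk L · over (ext ρ) t)
      bind-l {σ} (σ-zero , σ-suc) = cong lam (cong₂ _·_ (cong wk σ-zero) (subTm-over shift t))
        where shift : ∀ i → extsTm σ (ext (λ i → suc (ρ i)) i) ≡ var (ext ρ i)
              shift zero    = refl
              shift (suc i) = cong wk (σ-suc (ρ i))

  trC-β2 : (ρ : Fin m → Fin k) (t : STerm (suc n) m) (B : SType n) (l : SCoterm n m)
    (G K : Tm n k) →
    trC ρ (cut (Lam t) (tcons B l)) G K ⟶β⁺ trC ρ (cut (sub1TyT B t) l) G K
  trC-β2 ρ t B l G K =
    β-step bind-g ∷ β-step bind-k ∷ [ ξapp₂ (β2-step instantiate) ] ⁺◅◅
      trL-applied ρ l (sub1TyT B t) G K
    where
      L  = trL ρ l G K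
      K₁ = lam (wk L · (var zero ·T (B *)))

      bind-g : ∀ {σ} → IsSub₀ σ G →
        subTm σ (wk K₁ · Lam (over (λ i → suc (ρ i)) t)) ≡ K₁ · Lam (over ρ t)
      bind-g (σ-zero , σ-suc) =
        cong₂ _·_ (subTm-wk σ-suc K₁) (cong Lam (subTm-over (cong (renTyTm suc) ∘ σ-suc ∘ ρ) t))

      bind-k : ∀ {σ} → IsSub₀ σ (Lam (over ρ t)) →
        subTm σ (wk L · (var zero ·T (B *))) ≡ L · (Lam (over ρ t) ·T (B *))
      bind-k (σ-zero , σ-suc) = cong₂ _·_ (subTm-wk σ-suc L) (cong (_·T (B *)) σ-zero)

      instantiate : ∀ {σ} → σ zero ≡ B * → (∀ i → σ (suc i) ≡ tv i) →
        subTyTm σ (over ρ t) ≡ over ρ (sub1TyT B t)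
      instantiate σ-zero σ-suc = subTyTm-over (λ { zero → σ-zero ; (suc i) → σ-suc i }) t

  trC-π : (ρ : Fin m → Fin k) {E : SCoterm n m} → IsEval E → (t : STerm n m) (l : SCoterm n m)
    (G K : Tm n k) →
    trC ρ (cut (brace (cut t l)) E) G K ⟶β⁺ trC ρ (cut t (l ++L E)) G K
  trC-π ρ ev t l G K rewrite trC-IsEval ρ ev (brace (cut t l)) G K =
    trC-reduceG⁺ ρ (cut t l) _ (hs G) ⁺≡ trC-++L ρ ev t l G K

  trC-σ : (ρ : Fin m → Fin k) (t : STerm n m) (c : SCmd n (suc m)) (G K : Tm n k) →
    trC ρ (cut t (mu c)) G K ⟶β⁺ trC ρ (sub1C t c) G K
  trC-σ ρ t c G K = β-steps λ (σ-zero , σ-suc) →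
    trC-subst (t-realized σ-zero σ-suc refl (λ _ → refl)) c (subTm-wk σ-suc G) (subTm-wk σ-suc K)
    where
      t-realized : ∀ {σ θ} → σ zero ≡ over ρ t → (∀ i → σ (suc i) ≡ var i) →
        θ zero ≡ t → (∀ i → θ (suc i) ≡ var i) → Realizes θ (ext ρ) σ ρ
      t-realized σ-zero σ-suc θ-zero θ-suc = realizes λ where
        zero    → inj₂ (trans σ-zero (cong (over ρ) (sym θ-zero)))
        (suc i) → inj₁ (i , θ-suc i , σ-suc (ρ i))

  mutual
    trT-simulates : {t t' : STerm n m} → t ⟶T t' → (ρ : Fin m → Fin k) (G K : Tm n k) →
      trT ρ t G K ⟶β⁺ trT ρ t' G K
    trT-simulates (ε {t = t}) ρ G K = trT-reduceG⁺ ρ t K (hs G)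
    trT-simulates (ξlam p)   ρ G K =
      app₁⁺ (lam⁺ (app₂⁺ (lam⁺ (lam⁺ (app₂⁺ (over-simulates p _))))))
    trT-simulates (ξLam p)   ρ G K = app₁⁺ (lam⁺ (app₂⁺ (Lam⁺ (over-simulates p _))))
    trT-simulates (ξbrace p) ρ G K = trC-simulates p ρ (embed s · G) K

    over-simulates : {t t' : STerm n m} → t ⟶T t' → (ρ : Fin m → Fin k) → over ρ t ⟶β⁺ over ρ t'
    over-simulates p ρ = lam⁺ (lam⁺ (trT-simulates p _ _ _))

    trL-simulates : {l l' : SCoterm n m} → l ⟶L l' → (ρ : Fin m → Fin k) (G K : Tm n k) →
      trL ρ l G K ⟶β⁺ trL ρ l' G K
    trL-simulates (μ {l = l}) ρ G K = trL-μ ρ l G K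
    trL-simulates (ξcons₁ p)  ρ G K =
      lam⁺ (app₂⁺ (lam⁺ (app₂⁺ (wk-⟶β⁺ (wk-⟶β⁺ (over-simulates p ρ))))))
    trL-simulates (ξcons₂ p)  ρ G K =
      lam⁺ (app₂⁺ (lam⁺ (app₁⁺ (app₂⁺ (wk-⟶β⁺ (wk-⟶β⁺ (trL-simulates p ρ G K)))))))
    trL-simulates (ξtcons p)  ρ G K =
      lam⁺ (app₂⁺ (lam⁺ (app₁⁺ (wk-⟶β⁺ (wk-⟶β⁺ (trL-simulates p ρ G K))))))
    trL-simulates (ξmu p)     ρ G K = lam⁺ (trC-simulates p (ext ρ) (wk G) (wk K))

    trC-simulates : {c c' : SCmd n m} → c ⟶C c' → (ρ : Fin m → Fin k) (G K : Tm n k) →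
      trC ρ c G K ⟶β⁺ trC ρ c' G K
    trC-simulates (β {t = t} {u} {l})       ρ G K = trC-β ρ t u l G K
    trC-simulates (β2 {t = t} {B} {l})      ρ G K = trC-β2 ρ t B l G K
    trC-simulates (π {t = t} {l} ev)        ρ G K = trC-π ρ ev t l G K
    trC-simulates (σ-rule {t = t} {c})      ρ G K = trC-σ ρ t c G K
    trC-simulates (ξcut₁ {l = nil} p)       ρ G K = trT-simulates p ρ G K
    trC-simulates (ξcut₁ {l = cons u l} p)  ρ G K = trT-simulates p ρ G _
    trC-simulates (ξcut₁ {l = tcons B l} p) ρ G K = trT-simulates p ρ G _
    trC-simulates (ξcut₁ {l = mu c} p)      ρ G K = app₂⁺ (over-simulates p ρ)
    trC-simulates (ξcut₂ {t = t} p)         ρ G K = trC-coterm-simulates t p ρ G K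

    -- A μ-abstraction is translated as a function applied to t̄, not as a continuation.
    trC-coterm-simulates : {l l' : SCoterm n m} (t : STerm n m) → l ⟶L l' →
      (ρ : Fin m → Fin k) (G K : Tm n k) →
      trC ρ (cut t l) G K ⟶β⁺ trC ρ (cut t l') G K
    trC-coterm-simulates t (ξcons₁ p) ρ G K =
      trT-reduceK⁺ ρ t G (lam⁺ (app₂⁺ (wk-⟶β⁺ (over-simulates p ρ))))
    trC-coterm-simulates t (ξcons₂ p) ρ G K =
      trT-reduceK⁺ ρ t G (lam⁺ (app₁⁺ (app₂⁺ (wk-⟶β⁺ (trL-simulates p ρ G K)))))
    trC-coterm-simulates t (ξtcons p) ρ G K =
      trT-reduceK⁺ ρ t G (lam⁺ (app₁⁺ (wk-⟶β⁺ (trL-simulates p ρ G K))))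
    trC-coterm-simulates t (μ {l = l}) ρ G K = app₁⁺ (trL-μ ρ l G K) ⁺◅◅ trL-applied ρ l t G K
    trC-coterm-simulates t (ξmu {c' = c'} p) ρ G K =
      app₁⁺ (trL-simulates (ξmu p) ρ G K) ⁺◅◅ trL-applied ρ (mu c') t G K

theorem5p2 : (s : Tm 0 0) →
    ({n m : ℕ} (G : Tm n m) → (embed s · G) ⟶β⁺ G) →
    {n m : ℕ} {t u : STerm n m} → t ⟶T u → CGPS.⟦_⟧ s t ⟶β⁺ CGPS.⟦_⟧ s u
theorem5p2 s hs p = Simulation.over-simulates s hs p id
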